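{- Let $n\ge1$ and let $z_1,\ldots,z_n\in\mathbb{C}$ satisfy $z_1+\cdots+z_n=1$. For real $\alpha\ge0$ and integers $s_1,\ldots,s_n\ge0$ define $$S_{s_1,\ldots,s_n}(z;\alpha)=\sum_{k=1}^{n} z_k^{s_k+1}\sum_{\substack{0\le j_i\le s_i\\ i\ne k}}\frac{\Gamma\big(\alpha+s_k+\sum_{i\ne k}j_i+1\big)}{\Gamma(\alpha+1)\,s_k!\prod_{i\ne k}j_i!}\prod_{i\ne k}z_i^{j_i},$$ and set $S_{s_1,\ldots,s_n}(z;\alpha)=0$ whenever some $s_i=-1$. Then for $\alpha=0,1,2,\ldots$ and all $s_1,\ldots,s_n\ge0$, $$S_{s}(z;\alpha+1)-\sum_{i=1}^{n}z_i\,S_{s_1,\ldots,s_i-1,\ldots,s_n}(z;\alpha+1)=S_{s}(z;\alpha).$$ In particular, $$S_{s}(z;1)=1+\sum_{i=1}^{n}z_i\,S_{s_1,\ldots,s_i-1,\ldots,s_n}(z;1).$$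
   Context: $s=(s_1,\ldots,s_n)$; the inner sum runs over all $(j_i)_{i\ne k}$ with $0\le j_i\le s_i$. -}

module Defs where

open import Level using (Level)
open import Data.Nat using (ℕ; zero; suc; _+_; _*_; _∸_; _!; _/_; NonZero)
open import Data.Nat.Properties using (_!≢0; m*n≢0)
open import Data.Fin using (Fin; zero; suc; punchIn)
open import Data.List using (List; []; _∷_; map; concatMap; upTo)
open import Data.Vec.Functional using (Vector; updateAt)
import Data.Vec.Functional as VF
open import Data.Bool using (if_then_else_)
open import Data.Nat using (_≡ᵇ_)
open import Function using (_∘_)
open import Algebra.Bundles using (CommutativeRing)
import Data.Nat as N

ΣN : ∀ {m} → (Fin m → ℕ) → ℕ
ΣN = VF.foldr _+_ 0

∏! : ∀ m → (Fin m → ℕ) → ℕ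
∏! zero    j = 1
∏! (suc m) j = (j zero) ! * ∏! m (j ∘ suc)

∏!≢0 : ∀ m (j : Fin m → ℕ) → NonZero (∏! m j)
∏!≢0 zero    j = _
∏!≢0 (suc m) j = m*n≢0 ((j zero) !) (∏! m (j ∘ suc))
  {{(j zero) !≢0}} {{∏!≢0 m (j ∘ suc)}}

denom : ∀ m → ℕ → ℕ → (Fin m → ℕ) → ℕ
denom m α sk j = α ! * (sk ! * ∏! m j)

denom≢0 : ∀ m α sk (j : Fin m → ℕ) → NonZero (denom m α sk j)
denom≢0 m α sk j = m*n≢0 (α !) (sk ! * ∏! m j) {{α !≢0}}
  {{m*n≢0 (sk !) (∏! m j) {{sk !≢0}} {{∏!≢0 m j}}}}

-- coefficient  Γ(α + s_k + Σ j_i + 1) / (Γ(α+1) s_k! ∏ j_i!)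
-- for α ∈ ℕ, i.e. (α + s_k + Σ j_i)! / (α! s_k! ∏ j_i!)  (an exact division)
coef : ∀ m → ℕ → ℕ → (Fin m → ℕ) → ℕ
coef m α sk j = ((α + sk + ΣN j) ! / denom m α sk j) {{denom≢0 m α sk j}}

box : ∀ m → (Fin m → ℕ) → List (Fin m → ℕ)
box zero    b = (λ ()) ∷ []
box (suc m) b =
  concatMap (λ j0 → map (λ r → j0 VF.∷ r) (box m (b ∘ suc))) (upTo (suc (b zero)))

module _ {c ℓ : Level} (R : CommutativeRing c ℓ) where
  open CommutativeRing R using (Carrier; 0#; 1#) renaming (_+_ to _⊕_; _*_ to _⊛_)

  ι : ℕ → Carrier
  ι zero    = 0#
  ι (suc n) = 1# ⊕ ι n

  pow : Carrier → ℕ → Carrier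
  pow x zero    = 1#
  pow x (suc n) = x ⊛ pow x n

  ΣR : ∀ {m} → (Fin m → Carrier) → Carrier
  ΣR = VF.foldr _⊕_ 0#

  ∏R : ∀ {m} → (Fin m → Carrier) → Carrier
  ∏R = VF.foldr _⊛_ 1#

  ΣL : ∀ {a} {A : Set a} → List A → (A → Carrier) → Carrier
  ΣL []       f = 0#
  ΣL (x ∷ xs) f = f x ⊕ ΣL xs f

  -- S_{s_1..s_n}(z; α) for n = suc m, α ∈ ℕ.  Indices i ≠ k are
  -- enumerated as punchIn k i for i : Fin m.
  S : ∀ m → ℕ → (Fin (suc m) → Carrier) → (Fin (suc m) → ℕ) → Carrier
  S m α z s = ΣR λ k →
    pow (z k) (s k + 1) ⊛
    ΣL (box m (s ∘ punchIn k)) λ j →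
      ι (coef m α (s k) j) ⊛ ∏R (λ i → pow (z (punchIn k i)) (j i))

  -- S_{s_1,..,s_i - 1,..,s_n}(z; α), which is 0 when s_i - 1 = -1
  Sdec : ∀ m → ℕ → (Fin (suc m) → Carrier) → (Fin (suc m) → ℕ) →
         Fin (suc m) → Carrier
  Sdec m α z s i =
    if s i ≡ᵇ 0 then 0# else S m α z (updateAt s i (λ x → x ∸ 1))

module Submission where

-- For natural α the coefficient Γ(α + s_k + Σ j + 1) / (Γ(α+1) s_k! ∏ j_i!) of S is the
-- multinomial coefficient of (α, s_k, j), so it obeys Pascal's rule: it is [all entries 0]
-- plus the same coefficients with one of α, s_k, j_i lowered by one (module Multinomial).
-- Summing Pascal's rule against z_k^{s_k+1} ∏ z_i^{j_i} over the box 0 ≤ j ≤ s: lowering α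
-- gives the summands of S(z; α − 1), lowering s_k gives z_k times the k-th summand of
-- S_{s − e_k}, and lowering j_i becomes, after the index shift j ↦ j + e_i in the box
-- (module BoxSums), z_i times the k-th summand of S_{s − e_i}.  This is carried out once for
-- an arbitrary coefficient family obeying Pascal's rule (module Recurrence), which yields
-- S(z; α+1) = S(z; α) + Σ_i z_i S_{s − e_i}(z; α+1).  For α = 0 the remainder is
-- Σ_k z_k^{s_k+1} [s_k = 0], so induction on Σ s gives S(z; 0) = Σ_k z_k = 1 (module
-- SRecurrence).

open import Defs
open import Level using (Level)
open import Data.Nat using (ℕ; suc)
open import Data.Fin using (Fin)
open import Data.Product using (_×_; _,_)
open import Algebra.Bundles using (CommutativeRing)

-- Binomial and multinomial coefficients over ℕ and Pascal's rule for coef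
module Multinomial where

  open import Data.Bool using (if_then_else_)
  open import Data.Nat using (ℕ; zero; suc; _+_; _*_; _∸_; _!; _/_; _≡ᵇ_)
  open import Data.Nat.Properties
    using (+-identityʳ; *-identityʳ; +-suc; +-assoc; *-zeroʳ; *-distribʳ-+; suc-injective; +-*-semiring)
  open import Algebra.Properties.Semiring.Sum +-*-semiring using (sum-cong-≗; *-distribˡ-sum)
  open import Data.Nat.DivMod using (m*n/n≡m)
  open import Data.Nat.Solver using (module +-*-Solver)
  open import Data.Fin as Fin using (Fin; zero; suc; punchIn)
  open import Data.Fin.Properties using (punchInᵢ≢i; punchIn-injective)
  open import Data.Vec.Functional.Properties using (updateAt-updates; updateAt-minimal)
  open import Relation.Nullary using (yes; no)
  open import Data.Product using (_×_; _,_)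
  open import Data.Vec.Functional using (updateAt)
  import Data.Vec.Functional as VF
  open import Function using (_∘_)
  open import Relation.Binary.PropositionalEquality
  open +-*-Solver using (solve; _:+_; _:*_; _:=_; con)

  lower : ∀ {p} → (Fin p → ℕ) → Fin p → (Fin p → ℕ)
  lower v i = updateAt v i (_∸ 1)

  ifPos : ∀ {a} {A : Set a} → A → ℕ → A → A
  ifPos o n x = if n ≡ᵇ 0 then o else x

  δ₀ : ℕ → ℕ
  δ₀ zero    = 1
  δ₀ (suc _) = 0

  -- binom a b is the binomial coefficient (a + b choose a), defined by Pascal's rule
  binom : ℕ → ℕ → ℕ
  binom zero    b       = 1
  binom (suc a) zero    = 1
  binom (suc a) (suc b) = binom a (suc b) + binom (suc a) b

  binom-factorial : ∀ a b → binom a b * (a ! * b !) ≡ (a + b) !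
  binom-factorial zero    b    = trans (+-identityʳ _) (+-identityʳ _)
  binom-factorial (suc a) zero = trans (+-identityʳ _) (trans (*-identityʳ _)
                                   (cong _! (sym (+-identityʳ (suc a)))))
  binom-factorial (suc a) (suc b) = begin
      (binom a (suc b) + binom (suc a) b) * (suc a ! * suc b !)
    ≡⟨ split (binom a (suc b)) (binom (suc a) b) a b (a !) (b !) ⟩
      suc a * (binom a (suc b) * (a ! * suc b !)) + suc b * (binom (suc a) b * (suc a ! * b !))
    ≡⟨ cong₂ (λ x y → suc a * x + suc b * y)
         (trans (binom-factorial a (suc b)) (cong _! (+-suc a b))) (binom-factorial (suc a) b) ⟩
      suc a * suc (a + b) ! + suc b * suc (a + b) !
    ≡⟨ sym (*-distribʳ-+ (suc (a + b) !) (suc a) (suc b)) ⟩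
      (suc a + suc b) * suc (a + b) !
    ≡⟨ cong (λ n → suc (a + suc b) * n !) (sym (+-suc a b)) ⟩
      (suc a + suc b) !
    ∎
    where
    open ≡-Reasoning
    split : ∀ x y a b A B → (x + y) * ((suc a * A) * (suc b * B))
            ≡ suc a * (x * (A * (suc b * B))) + suc b * (y * ((suc a * A) * B))
    split = solve 6 (λ x y a b A B →
      (x :+ y) :* (((con 1 :+ a) :* A) :* ((con 1 :+ b) :* B))
        := (con 1 :+ a) :* (x :* (A :* ((con 1 :+ b) :* B)))
           :+ (con 1 :+ b) :* (y :* (((con 1 :+ a) :* A) :* B))) refl

  binom-zero : ∀ a → binom a 0 ≡ 1
  binom-zero zero    = refl
  binom-zero (suc a) = refl

  multinomial : ∀ {p} → (Fin p → ℕ) → ℕ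
  multinomial {zero}  v = 1
  multinomial {suc p} v = binom (v zero) (ΣN (v ∘ suc)) * multinomial (v ∘ suc)

  multinomial-factorial : ∀ {p} (v : Fin p → ℕ) → multinomial v * ∏! p v ≡ (ΣN v) !
  multinomial-factorial {zero}  v = refl
  multinomial-factorial {suc p} v = begin
      binom v₀ N * M * (v₀ ! * P)
    ≡⟨ regroup (binom v₀ N) M (v₀ !) P ⟩
      binom v₀ N * (v₀ ! * (M * P))
    ≡⟨ cong (λ x → binom v₀ N * (v₀ ! * x)) (multinomial-factorial (v ∘ suc)) ⟩
      binom v₀ N * (v₀ ! * N !)
    ≡⟨ binom-factorial v₀ N ⟩
      (v₀ + N) !
    ∎
    where
    open ≡-Reasoning
    v₀ = v zero
    N = ΣN (v ∘ suc)
    M = multinomial (v ∘ suc)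
    P = ∏! p (v ∘ suc)
    regroup : ∀ b m f q → b * m * (f * q) ≡ b * (f * (m * q))
    regroup = solve 4 (λ b m f q → b :* m :* (f :* q) := b :* (f :* (m :* q))) refl

  multinomial-cong : ∀ {p} {v v' : Fin p → ℕ} → (∀ i → v i ≡ v' i) → multinomial v ≡ multinomial v'
  multinomial-cong {zero}  e = refl
  multinomial-cong {suc p} e =
    cong₂ _*_ (cong₂ binom (e zero) (sum-cong-≗ (e ∘ suc))) (multinomial-cong (e ∘ suc))

  ΣN-lower : ∀ {p} (v : Fin p → ℕ) i {x} → v i ≡ suc x → ΣN v ≡ suc (ΣN (lower v i))
  ΣN-lower v zero    e rewrite e = refl
  ΣN-lower v (suc i) e = trans (cong (v zero +_) (ΣN-lower (v ∘ suc) i e)) (+-suc _ _)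

  ΣN-ifPos-zero : ∀ {p} (v Y : Fin p → ℕ) → ΣN v ≡ 0 → ΣN (λ i → ifPos 0 (v i) (Y i)) ≡ 0
  ΣN-ifPos-zero {zero}  v Y e = refl
  ΣN-ifPos-zero {suc p} v Y e with v zero
  ... | zero = ΣN-ifPos-zero (v ∘ suc) (Y ∘ suc) e

  ΣN-ifPos-total : ∀ {p} (v : Fin p → ℕ) d (f : ℕ → ℕ) (X : Fin p → ℕ) → ΣN v ≡ suc d →
    ΣN (λ i → ifPos 0 (v i) (f (ΣN (lower v i)) * X i)) ≡ f d * ΣN (λ i → ifPos 0 (v i) (X i))
  ΣN-ifPos-total v d f X e =
    trans (sum-cong-≗ termwise) (sym (*-distribˡ-sum (f d) (λ i → ifPos 0 (v i) (X i))))
    where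
    termwise : ∀ i → ifPos 0 (v i) (f (ΣN (lower v i)) * X i) ≡ f d * ifPos 0 (v i) (X i)
    termwise i with v i in vᵢ
    ... | zero  = sym (*-zeroʳ (f d))
    ... | suc x = cong (λ n → f n * X i) (suc-injective (trans (sym (ΣN-lower v i vᵢ)) e))

  -- Pascal's rule for the first coordinate, the remaining coordinates being
  -- abstracted to their total N, their multinomial M and the guarded sum Σ'
  -- appearing in Pascal's rule for them
  pascal-step : ∀ a N M Σ' T → M ≡ δ₀ N + Σ' →
    (N ≡ 0 → Σ' ≡ 0 × T ≡ 0) → (∀ d → N ≡ suc d → T ≡ binom a d * Σ') →
    binom a N * M ≡ δ₀ (a + N) + (ifPos 0 a (binom (a ∸ 1) N * M) + T)
  pascal-step a zero M Σ' T refl vanish _ with vanish refl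
  ... | refl , refl rewrite +-identityʳ a = empty-rest a
    where
    empty-rest : ∀ a → binom a 0 * 1 ≡ δ₀ a + (ifPos 0 a (binom (a ∸ 1) 0 * 1) + 0)
    empty-rest zero    = refl
    empty-rest (suc a) = cong (λ n → n * 1 + 0) (sym (binom-zero a))
  pascal-step a (suc d) M Σ' T refl _ total rewrite total d refl | +-suc a d = binom-rule a
    where
    binom-rule : ∀ a → binom a (suc d) * Σ' ≡ ifPos 0 a (binom (a ∸ 1) (suc d) * Σ') + binom a d * Σ'
    binom-rule zero    = refl
    binom-rule (suc a) = *-distribʳ-+ Σ' (binom a (suc d)) (binom (suc a) d)

  multinomial-pascal : ∀ {p} (v : Fin p → ℕ) →
    multinomial v ≡ δ₀ (ΣN v) + ΣN (λ i → ifPos 0 (v i) (multinomial (lower v i)))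
  multinomial-pascal {zero}  v = refl
  multinomial-pascal {suc p} v =
    pascal-step (v zero) (ΣN v') (multinomial v') _ _ (multinomial-pascal v')
      (λ N≡0 → ΣN-ifPos-zero v' _ N≡0 , ΣN-ifPos-zero v' _ N≡0)
      (λ d N≡1+d → ΣN-ifPos-total v' d (binom (v zero)) (λ i → multinomial (lower v' i)) N≡1+d)
    where v' = v ∘ suc

  coef≡multinomial : ∀ m α a j → coef m α a j ≡ multinomial (α VF.∷ (a VF.∷ j))
  coef≡multinomial m α a j = begin
      ((α + a + ΣN j) ! / D) {{D≢0}}
    ≡⟨ cong (λ n → (n ! / D) {{D≢0}}) (+-assoc α a (ΣN j)) ⟩
      ((α + (a + ΣN j)) ! / D) {{D≢0}}
    ≡⟨ cong (λ n → (n / D) {{D≢0}}) (sym (multinomial-factorial v)) ⟩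
      ((multinomial v * D) / D) {{D≢0}}
    ≡⟨ m*n/n≡m (multinomial v) D {{D≢0}} ⟩
      multinomial v
    ∎
    where
    open ≡-Reasoning
    v = α VF.∷ (a VF.∷ j)
    D = denom m α a j
    D≢0 = denom≢0 m α a j

  coef-cong : ∀ m α a {j j' : Fin m → ℕ} → (∀ i → j i ≡ j' i) → coef m α a j ≡ coef m α a j'
  coef-cong m α a {j} {j'} e =
    trans (coef≡multinomial m α a j)
      (trans (multinomial-cong pointwise) (sym (coef≡multinomial m α a j')))
    where
    pointwise : ∀ i → (α VF.∷ (a VF.∷ j)) i ≡ (α VF.∷ (a VF.∷ j')) i
    pointwise zero          = refl
    pointwise (suc zero)    = refl
    pointwise (suc (suc i)) = e i

  coef-α↓ : ∀ m → ℕ → ℕ → (Fin m → ℕ) → ℕ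
  coef-α↓ m α a j = δ₀ (α + (a + ΣN j)) + ifPos 0 α (coef m (α ∸ 1) a j)

  coef-pascal : ∀ m α a j → coef m α a j ≡
    coef-α↓ m α a j + ifPos 0 a (coef m α (a ∸ 1) j)
      + ΣN (λ i → ifPos 0 (j i) (coef m α a (lower j i)))
  coef-pascal m α a j = begin
      coef m α a j
    ≡⟨ coef≡multinomial m α a j ⟩
      multinomial (α VF.∷ (a VF.∷ j))
    ≡⟨ multinomial-pascal (α VF.∷ (a VF.∷ j)) ⟩
      δ₀ (α + (a + ΣN j)) + (ifPos 0 α (multinomial ((α ∸ 1) VF.∷ (a VF.∷ j)))
        + (ifPos 0 a (multinomial (α VF.∷ ((a ∸ 1) VF.∷ j)))
        + ΣN (λ i → ifPos 0 (j i) (multinomial (α VF.∷ (a VF.∷ lower j i))))))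
    ≡⟨ cong₂ (λ x y → δ₀ (α + (a + ΣN j)) + (ifPos 0 α x + y)) (sym (coef≡multinomial m (α ∸ 1) a j))
         (cong₂ (λ x y → ifPos 0 a x + y) (sym (coef≡multinomial m α (a ∸ 1) j))
           (sum-cong-≗ (λ i → cong (ifPos 0 (j i)) (sym (coef≡multinomial m α a (lower j i)))))) ⟩
      δ₀ (α + (a + ΣN j)) + (ifPos 0 α (coef m (α ∸ 1) a j) + (ifPos 0 a (coef m α (a ∸ 1) j)
        + ΣN (λ i → ifPos 0 (j i) (coef m α a (lower j i)))))
    ≡⟨ sym (trans (+-assoc (coef-α↓ m α a j) _ _) (+-assoc (δ₀ (α + (a + ΣN j))) _ _)) ⟩
      coef-α↓ m α a j + ifPos 0 a (coef m α (a ∸ 1) j) + ΣN (λ i → ifPos 0 (j i) (coef m α a (lower j i)))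
    ∎
    where open ≡-Reasoning

  lower-punchIn : ∀ {m} (s : Fin (suc m) → ℕ) k i x →
    lower s (punchIn k i) (punchIn k x) ≡ lower (s ∘ punchIn k) i x
  lower-punchIn s k i x with x Fin.≟ i
  ... | yes refl = trans (updateAt-updates (punchIn k x) s) (sym (updateAt-updates x (s ∘ punchIn k)))
  ... | no x≢i   = trans (updateAt-minimal (punchIn k x) (punchIn k i) s (x≢i ∘ punchIn-injective k x i))
                     (sym (updateAt-minimal x i (s ∘ punchIn k) x≢i))

  lower-punchIn-self : ∀ {m} (s : Fin (suc m) → ℕ) k x → lower s k (punchIn k x) ≡ s (punchIn k x)
  lower-punchIn-self s k x = updateAt-minimal (punchIn k x) k s (punchInᵢ≢i k x)


-- Sums in a commutative ring over lists and over boxes of exponent vectors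
module BoxSums {c ℓ : Level} (R : CommutativeRing c ℓ) where

  open import Data.Nat using (zero; suc; _∸_)
  open import Data.Fin using (zero; suc)
  open import Data.List using (List; []; _∷_; _++_; map; concatMap; upTo)
  open import Data.List.Properties using (map-applyUpTo)
  import Data.Vec.Functional as VF
  open import Function using (id; _∘_)
  open import Relation.Binary.PropositionalEquality as P using (_≡_)
  open CommutativeRing R hiding (zero)
  open import Relation.Binary.Reasoning.Setoid setoid
  open import Algebra.Properties.Semiring.Sum semiring
    using (sum-replicate-zero; ∑-distrib-+; *-distribʳ-sum)
  open Multinomial using (lower; ifPos)
  open import Algebra.Properties.CommutativeSemigroup *-commutativeSemigroup using (x∙yz≈y∙xz)
  open import Algebra.Properties.CommutativeSemigroup +-commutativeSemigroup
    using () renaming (interchange to +-interchange)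

  ifPos-cong : ∀ n {x y} → x ≈ y → ifPos 0# n x ≈ ifPos 0# n y
  ifPos-cong zero    _   = refl
  ifPos-cong (suc n) x≈y = x≈y

  ifPos-*ʳ : ∀ n x y → ifPos 0# n x * y ≈ ifPos 0# n (x * y)
  ifPos-*ʳ zero    x y = zeroˡ y
  ifPos-*ʳ (suc n) x y = refl

  ifPos-*ˡ : ∀ n x y → x * ifPos 0# n y ≈ ifPos 0# n (x * y)
  ifPos-*ˡ zero    x y = zeroʳ x
  ifPos-*ˡ (suc n) x y = refl

  ΣR-ifPos : ∀ {m} n (f : Fin m → Carrier) → ΣR R (λ k → ifPos 0# n (f k)) ≈ ifPos 0# n (ΣR R f)
  ΣR-ifPos {m} zero    f = sum-replicate-zero m
  ΣR-ifPos     (suc n) f = refl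

  module _ {a} {A : Set a} where

    ΣL-cong : (xs : List A) {f g : A → Carrier} → (∀ x → f x ≈ g x) → ΣL R xs f ≈ ΣL R xs g
    ΣL-cong []       e = refl
    ΣL-cong (x ∷ xs) e = +-cong (e x) (ΣL-cong xs e)

    ΣL-+ : (xs : List A) (f g : A → Carrier) → ΣL R xs (λ x → f x + g x) ≈ ΣL R xs f + ΣL R xs g
    ΣL-+ []       f g = sym (+-identityˡ 0#)
    ΣL-+ (x ∷ xs) f g = trans (+-congˡ (ΣL-+ xs f g)) (+-interchange (f x) (g x) _ _)

    ΣL-scale : (xs : List A) (y : Carrier) (f : A → Carrier) → ΣL R xs (λ x → y * f x) ≈ y * ΣL R xs f
    ΣL-scale []       y f = sym (zeroʳ y)
    ΣL-scale (x ∷ xs) y f = trans (+-congˡ (ΣL-scale xs y f)) (sym (distribˡ y _ _))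

    ΣL-zero : (xs : List A) → ΣL R xs (λ _ → 0#) ≈ 0#
    ΣL-zero []       = refl
    ΣL-zero (x ∷ xs) = trans (+-identityˡ _) (ΣL-zero xs)

    ΣL-ifPos : (xs : List A) (n : ℕ) (f : A → Carrier) → ΣL R xs (λ x → ifPos 0# n (f x)) ≈ ifPos 0# n (ΣL R xs f)
    ΣL-ifPos xs zero    f = ΣL-zero xs
    ΣL-ifPos xs (suc n) f = refl

    ΣL-ΣR : (xs : List A) {m : ℕ} (F : A → Fin m → Carrier) →
            ΣL R xs (λ x → ΣR R (F x)) ≈ ΣR R (λ i → ΣL R xs (λ x → F x i))
    ΣL-ΣR []       {m} F = sym (sum-replicate-zero m)
    ΣL-ΣR (x ∷ xs)     F = trans (+-congˡ (ΣL-ΣR xs F)) (sym (∑-distrib-+ (F x) _))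

    ΣL-++ : (xs ys : List A) (f : A → Carrier) → ΣL R (xs ++ ys) f ≈ ΣL R xs f + ΣL R ys f
    ΣL-++ []       ys f = sym (+-identityˡ _)
    ΣL-++ (x ∷ xs) ys f = trans (+-congˡ (ΣL-++ xs ys f)) (sym (+-assoc _ _ _))

  ΣL-concatMap : ∀ {a b} {A : Set a} {B : Set b} (g : A → List B) (xs : List A) (f : B → Carrier) →
                 ΣL R (concatMap g xs) f ≈ ΣL R xs (λ x → ΣL R (g x) f)
  ΣL-concatMap g []       f = refl
  ΣL-concatMap g (x ∷ xs) f = trans (ΣL-++ (g x) (concatMap g xs) f) (+-congˡ (ΣL-concatMap g xs f))

  ΣL-map : ∀ {a b} {A : Set a} {B : Set b} (g : A → B) (xs : List A) (f : B → Carrier) →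
           ΣL R (map g xs) f ≡ ΣL R xs (f ∘ g)
  ΣL-map g []       f = P.refl
  ΣL-map g (x ∷ xs) f = P.cong (f (g x) +_) (ΣL-map g xs f)

  ΣL-upTo-suc : ∀ n (f : ℕ → Carrier) → ΣL R (upTo (suc n)) f ≈ f 0 + ΣL R (upTo n) (f ∘ suc)
  ΣL-upTo-suc n f = +-congˡ (reflexive (P.trans (P.cong (λ xs → ΣL R xs f) (P.sym (map-applyUpTo id suc n)))
                                          (ΣL-map suc (upTo n) f)))

  monomial : ∀ {m} → (Fin m → Carrier) → (Fin m → ℕ) → Carrier
  monomial w j = ∏R R (λ i → pow R (w i) (j i))

  boxSum : ∀ {m} → (Fin m → ℕ) → (Fin m → Carrier) → ((Fin m → ℕ) → Carrier) → Carrier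
  boxSum {m} b w F = ΣL R (box m b) (λ j → F j * monomial w j)

  Extensional : ∀ {m} → ((Fin m → ℕ) → Carrier) → Set ℓ
  Extensional F = ∀ {j j'} → (∀ x → j x ≡ j' x) → F j ≈ F j'

  box-cong : ∀ m {b b' : Fin m → ℕ} → (∀ i → b i ≡ b' i) → box m b ≡ box m b'
  box-cong zero    e = P.refl
  box-cong (suc m) {b} {b'} e
    rewrite e zero | box-cong m {b ∘ suc} {b' ∘ suc} (e ∘ suc) = P.refl

  boxSum-cong-bound : ∀ {m} {b b' : Fin m → ℕ} w F → (∀ i → b i ≡ b' i) → boxSum b w F ≡ boxSum b' w F
  boxSum-cong-bound {m} w F e = P.cong (λ bx → ΣL R bx (λ j → F j * monomial w j)) (box-cong m e)

  module _ {m} (b : Fin m → ℕ) (w : Fin m → Carrier) where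

    boxSum-cong : ∀ {F G} → (∀ j → F j ≈ G j) → boxSum b w F ≈ boxSum b w G
    boxSum-cong e = ΣL-cong (box m b) (λ j → *-congʳ (e j))

    boxSum-zero : boxSum b w (λ _ → 0#) ≈ 0#
    boxSum-zero = trans (ΣL-cong (box m b) (λ j → zeroˡ _)) (ΣL-zero (box m b))

    boxSum-+ : ∀ F G → boxSum b w (λ j → F j + G j) ≈ boxSum b w F + boxSum b w G
    boxSum-+ F G = trans (ΣL-cong (box m b) (λ j → distribʳ (monomial w j) (F j) (G j))) (ΣL-+ (box m b) _ _)

    boxSum-ifPos : ∀ n F → boxSum b w (λ j → ifPos 0# n (F j)) ≈ ifPos 0# n (boxSum b w F)
    boxSum-ifPos n F =
      trans (ΣL-cong (box m b) (λ j → ifPos-*ʳ n (F j) (monomial w j))) (ΣL-ifPos (box m b) n _)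

    boxSum-ΣR : ∀ {n} (F : Fin n → (Fin m → ℕ) → Carrier) →
                boxSum b w (λ j → ΣR R (λ i → F i j)) ≈ ΣR R (λ i → boxSum b w (F i))
    boxSum-ΣR F = trans (ΣL-cong (box m b) (λ j → *-distribʳ-sum (monomial w j) (λ i → F i j)))
                        (ΣL-ΣR (box m b) (λ j i → F i j * monomial w j))

  boxSum-suc : ∀ {m} (b : Fin (suc m) → ℕ) w F →
    boxSum b w F ≈ ΣL R (upTo (suc (b zero)))
                     (λ t → pow R (w zero) t * boxSum (b ∘ suc) (w ∘ suc) (λ r → F (t VF.∷ r)))
  boxSum-suc {m} b w F = begin
      ΣL R (concatMap (λ t → map (t VF.∷_) (box m (b ∘ suc))) (upTo (suc (b zero)))) (λ j → F j * monomial w j)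
    ≈⟨ ΣL-concatMap (λ t → map (t VF.∷_) (box m (b ∘ suc))) (upTo (suc (b zero))) (λ j → F j * monomial w j) ⟩
      ΣL R (upTo (suc (b zero))) (λ t → ΣL R (map (t VF.∷_) (box m (b ∘ suc))) (λ j → F j * monomial w j))
    ≈⟨ ΣL-cong (upTo (suc (b zero))) (λ t → trans (reflexive (ΣL-map (t VF.∷_) (box m (b ∘ suc)) _))
         (trans (ΣL-cong (box m (b ∘ suc)) (λ r → x∙yz≈y∙xz (F (t VF.∷ r)) _ _))
                (ΣL-scale (box m (b ∘ suc)) _ _))) ⟩
      ΣL R (upTo (suc (b zero))) (λ t → pow R (w zero) t * boxSum (b ∘ suc) (w ∘ suc) (λ r → F (t VF.∷ r)))
    ∎

  interval-shift : ∀ b (g : ℕ → Carrier) →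
    ΣL R (upTo (suc b)) (λ t → ifPos 0# t (g (t ∸ 1))) ≈ ifPos 0# b (ΣL R (upTo (suc (b ∸ 1))) g)
  interval-shift b g = trans (ΣL-upTo-suc b _) (drop-zero b)
    where
    drop-zero : ∀ b → 0# + ΣL R (upTo b) g ≈ ifPos 0# b (ΣL R (upTo (suc (b ∸ 1))) g)
    drop-zero zero    = +-identityʳ 0#
    drop-zero (suc b) = +-identityˡ _

  lower-∷-zero : ∀ {m} t (r : Fin m → ℕ) x → lower (t VF.∷ r) zero x ≡ ((t ∸ 1) VF.∷ r) x
  lower-∷-zero t r zero    = P.refl
  lower-∷-zero t r (suc x) = P.refl

  lower-∷-suc : ∀ {m} t (r : Fin m → ℕ) i x → lower (t VF.∷ r) (suc i) x ≡ (t VF.∷ lower r i) x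
  lower-∷-suc t r i zero    = P.refl
  lower-∷-suc t r i (suc x) = P.refl

  ∷-cong : ∀ {m} t {r r' : Fin m → ℕ} → (∀ x → r x ≡ r' x) → ∀ x → (t VF.∷ r) x ≡ (t VF.∷ r') x
  ∷-cong t e zero    = P.refl
  ∷-cong t e (suc x) = e x

  boxSum-shift : ∀ {m} (i : Fin m) b w F → Extensional F →
    boxSum b w (λ j → ifPos 0# (j i) (F (lower j i))) ≈ ifPos 0# (b i) (w i * boxSum (lower b i) w F)
  boxSum-shift {suc m} zero b w F ext = begin
      boxSum b w (λ j → ifPos 0# (j zero) (F (lower j zero)))
    ≈⟨ boxSum-suc b w _ ⟩
      ΣL R (upTo (suc b₀)) (λ t → pow R w₀ t * boxSum b' w' (λ r → ifPos 0# t (F (lower (t VF.∷ r) zero))))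
    ≈⟨ ΣL-cong (upTo (suc b₀)) (λ t → *-congˡ (trans
         (boxSum-cong b' w' (λ r → ifPos-cong t (ext (lower-∷-zero t r)))) (boxSum-ifPos b' w' t _))) ⟩
      ΣL R (upTo (suc b₀)) (λ t → pow R w₀ t * ifPos 0# t (G (t ∸ 1)))
    ≈⟨ ΣL-cong (upTo (suc b₀)) pull-w₀ ⟩
      ΣL R (upTo (suc b₀)) (λ t → ifPos 0# t (w₀ * (pow R w₀ (t ∸ 1) * G (t ∸ 1))))
    ≈⟨ interval-shift b₀ (λ u → w₀ * (pow R w₀ u * G u)) ⟩
      ifPos 0# b₀ (ΣL R (upTo (suc (b₀ ∸ 1))) (λ u → w₀ * (pow R w₀ u * G u)))
    ≈⟨ ifPos-cong b₀ (trans (ΣL-scale (upTo (suc (b₀ ∸ 1))) w₀ _)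
                            (*-congˡ (sym (boxSum-suc (lower b zero) w F)))) ⟩
      ifPos 0# b₀ (w₀ * boxSum (lower b zero) w F)
    ∎
    where
    b₀ = b zero
    b' = b ∘ suc
    w₀ = w zero
    w' = w ∘ suc
    G : ℕ → Carrier
    G u = boxSum b' w' (λ r → F (u VF.∷ r))
    pull-w₀ : ∀ t → pow R w₀ t * ifPos 0# t (G (t ∸ 1)) ≈ ifPos 0# t (w₀ * (pow R w₀ (t ∸ 1) * G (t ∸ 1)))
    pull-w₀ zero    = zeroʳ _
    pull-w₀ (suc u) = *-assoc w₀ (pow R w₀ u) (G u)
  boxSum-shift {suc m} (suc i) b w F ext = begin
      boxSum b w (λ j → ifPos 0# (j (suc i)) (F (lower j (suc i))))
    ≈⟨ boxSum-suc b w _ ⟩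
      ΣL R (upTo (suc b₀)) (λ t → pow R w₀ t * boxSum b' w' (λ r → ifPos 0# (r i) (F (lower (t VF.∷ r) (suc i)))))
    ≈⟨ ΣL-cong (upTo (suc b₀)) (λ t → *-congˡ (trans
         (boxSum-cong b' w' (λ r → ifPos-cong (r i) (ext (lower-∷-suc t r i))))
         (boxSum-shift i b' w' (λ r → F (t VF.∷ r)) (λ e → ext (∷-cong t e))))) ⟩
      ΣL R (upTo (suc b₀)) (λ t → pow R w₀ t * ifPos 0# (b' i) (w' i * H t))
    ≈⟨ ΣL-cong (upTo (suc b₀)) (λ t → trans (ifPos-*ˡ (b' i) _ _) (ifPos-cong (b' i) (x∙yz≈y∙xz _ _ _))) ⟩
      ΣL R (upTo (suc b₀)) (λ t → ifPos 0# (b' i) (w' i * (pow R w₀ t * H t)))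
    ≈⟨ trans (ΣL-ifPos (upTo (suc b₀)) (b' i) _) (ifPos-cong (b' i) (ΣL-scale (upTo (suc b₀)) (w' i) _)) ⟩
      ifPos 0# (b' i) (w' i * ΣL R (upTo (suc b₀)) (λ t → pow R w₀ t * H t))
    ≈⟨ ifPos-cong (b' i) (*-congˡ (sym (boxSum-suc (lower b (suc i)) w F))) ⟩
      ifPos 0# (b (suc i)) (w (suc i) * boxSum (lower b (suc i)) w F)
    ∎
    where
    b₀ = b zero
    b' = b ∘ suc
    w₀ = w zero
    w' = w ∘ suc
    H : ℕ → Carrier
    H t = boxSum (lower b' i) w' (λ r → F (t VF.∷ r))

-- S with an arbitrary coefficient family, and the lifting of Pascal's rule to it
module Recurrence {c ℓ : Level} (R : CommutativeRing c ℓ) where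

  open import Data.Nat as ℕ using (zero; suc; _∸_)
  open import Data.Fin using (punchIn)
  open import Data.Fin.Properties using (punchInᵢ≢i)
  open import Data.Vec.Functional.Properties using (updateAt-updates; updateAt-minimal)
  open import Function using (_∘_)
  open import Relation.Binary.PropositionalEquality as P using (_≡_)
  open CommutativeRing R hiding (zero)
  open import Relation.Binary.Reasoning.Setoid setoid
  open import Algebra.Properties.Semiring.Sum semiring
    using (sum-cong-≋; ∑-distrib-+; ∑-comm; sum-remove; *-distribˡ-sum)
  open import Algebra.Properties.CommutativeSemigroup *-commutativeSemigroup using (x∙yz≈y∙xz)
  open Multinomial using (lower; ifPos; lower-punchIn; lower-punchIn-self)
  open BoxSums R

  -- a coefficient family: F a j is the coefficient attached to s_k = a and (j_i)_{i ≠ k} = j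
  Family : ℕ → Set c
  Family m = ℕ → (Fin m → ℕ) → Carrier

  -- the k-th summand of S with coefficients F, and the whole sum;
  -- S R m α is Sfam with the family a j ↦ ι (coef m α a j)
  Sterm : ∀ {m} → Family m → (Fin (suc m) → Carrier) → (Fin (suc m) → ℕ) → Fin (suc m) → Carrier
  Sterm F z s k = pow R (z k) (s k ℕ.+ 1) * boxSum (s ∘ punchIn k) (z ∘ punchIn k) (F (s k))

  Sfam : ∀ {m} → Family m → (Fin (suc m) → Carrier) → (Fin (suc m) → ℕ) → Carrier
  Sfam F z s = ΣR R (Sterm F z s)

  Pascal : ∀ {m} → Family m → Family m → Set ℓ
  Pascal F G = ∀ a j →
    F a j ≈ G a j + ifPos 0# a (F (a ∸ 1) j) + ΣR R (λ i → ifPos 0# (j i) (F a (lower j i)))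

  Sterm-at : ∀ {m} (F : Family m) z s k {x} {b : Fin m → ℕ} → s k ≡ x → (∀ i → s (punchIn k i) ≡ b i) →
             Sterm F z s k ≡ pow R (z k) (x ℕ.+ 1) * boxSum b (z ∘ punchIn k) (F x)
  Sterm-at F z s k P.refl e =
    P.cong (pow R (z k) (s k ℕ.+ 1) *_) (boxSum-cong-bound (z ∘ punchIn k) (F (s k)) e)

  module _ {m} {F G : Family m} (pascal : Pascal F G) (ext : ∀ a → Extensional (F a)) where

    -- Pascal's rule lifts to truncated generating functions, the jᵢ-lowering
    -- terms becoming index shifts of the box
    boxSum-pascal : ∀ a b w →
      boxSum b w (F a) ≈ boxSum b w (G a) + ifPos 0# a (boxSum b w (F (a ∸ 1)))
                         + ΣR R (λ i → ifPos 0# (b i) (w i * boxSum (lower b i) w (F a)))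
    boxSum-pascal a b w = begin
        boxSum b w (F a)
      ≈⟨ boxSum-cong b w (pascal a) ⟩
        boxSum b w (λ j → G a j + ifPos 0# a (F (a ∸ 1) j) + ΣR R (λ i → ifPos 0# (j i) (F a (lower j i))))
      ≈⟨ trans (boxSum-+ b w _ _) (+-congʳ (boxSum-+ b w _ _)) ⟩
        boxSum b w (G a) + boxSum b w (λ j → ifPos 0# a (F (a ∸ 1) j))
          + boxSum b w (λ j → ΣR R (λ i → ifPos 0# (j i) (F a (lower j i))))
      ≈⟨ +-cong (+-congˡ (boxSum-ifPos b w a (F (a ∸ 1))))
                (trans (boxSum-ΣR b w (λ i j → ifPos 0# (j i) (F a (lower j i))))
                       (sum-cong-≋ (λ i → boxSum-shift i b w (F a) (ext a)))) ⟩
        boxSum b w (G a) + ifPos 0# a (boxSum b w (F (a ∸ 1)))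
          + ΣR R (λ i → ifPos 0# (b i) (w i * boxSum (lower b i) w (F a)))
      ∎

    -- the k-th summand of Sfam F z s decomposes along Pascal's rule into the
    -- remainder term and, for every i, z_i [s_i > 0] times the k-th summand of
    -- Sfam F z (s − e_i): for i = k this is the a-lowering term, for i ≠ k a shift term
    Sterm-pascal : ∀ z s k →
      Sterm F z s k ≈ Sterm G z s k + ΣR R (λ i → z i * ifPos 0# (s i) (Sterm F z (lower s i) k))
    Sterm-pascal z s k = begin
        P * boxSum b w (F a)
      ≈⟨ *-congˡ (boxSum-pascal a b w) ⟩
        P * (boxSum b w (G a) + ifPos 0# a (boxSum b w (F (a ∸ 1))) + ΣR R shifted)
      ≈⟨ trans (distribˡ P _ (ΣR R shifted))
           (trans (+-cong (distribˡ P _ _) (*-distribˡ-sum P shifted)) (+-assoc _ _ _)) ⟩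
        P * boxSum b w (G a) + (P * ifPos 0# a (boxSum b w (F (a ∸ 1))) + ΣR R (λ i → P * shifted i))
      ≈⟨ +-congˡ (+-cong (sym diagonal) (sum-cong-≋ (λ i → sym (off-diagonal i)))) ⟩
        Sterm G z s k + (U k + ΣR R (U ∘ punchIn k))
      ≈⟨ +-congˡ (sym (sum-remove {i = k} U)) ⟩
        Sterm G z s k + ΣR R U
      ∎
      where
      a = s k
      P = pow R (z k) (a ℕ.+ 1)
      b = s ∘ punchIn k
      w = z ∘ punchIn k
      shifted : Fin m → Carrier
      shifted i = ifPos 0# (b i) (w i * boxSum (lower b i) w (F a))
      U : Fin (suc m) → Carrier
      U i = z i * ifPos 0# (s i) (Sterm F z (lower s i) k)
      absorb : ∀ n x Y → x * ifPos 0# n (pow R x ((n ∸ 1) ℕ.+ 1) * Y) ≈ pow R x (n ℕ.+ 1) * ifPos 0# n Y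
      absorb zero    x Y = trans (zeroʳ x) (sym (zeroʳ _))
      absorb (suc n) x Y = sym (*-assoc x _ Y)
      diagonal : U k ≈ P * ifPos 0# a (boxSum b w (F (a ∸ 1)))
      diagonal = trans (*-congˡ (ifPos-cong a (reflexive (Sterm-at F z (lower s k) k
                   (updateAt-updates k s) (lower-punchIn-self s k)))))
                 (absorb a (z k) _)
      exchange : ∀ n x y Y → x * ifPos 0# n (y * Y) ≈ y * ifPos 0# n (x * Y)
      exchange zero    x y Y = trans (zeroʳ x) (sym (zeroʳ y))
      exchange (suc n) x y Y = x∙yz≈y∙xz x y Y
      off-diagonal : ∀ i → U (punchIn k i) ≈ P * shifted i
      off-diagonal i = trans (*-congˡ (ifPos-cong (b i) (reflexive (Sterm-at F z (lower s (punchIn k i)) k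
                         (updateAt-minimal k (punchIn k i) s (punchInᵢ≢i k i ∘ P.sym)) (lower-punchIn s k i)))))
                       (exchange (b i) (w i) P _)

    Sfam-pascal : ∀ z s →
      Sfam F z s ≈ Sfam G z s + ΣR R (λ i → z i * ifPos 0# (s i) (Sfam F z (lower s i)))
    Sfam-pascal z s = begin
        ΣR R (Sterm F z s)
      ≈⟨ sum-cong-≋ (Sterm-pascal z s) ⟩
        ΣR R (λ k → Sterm G z s k + ΣR R (λ i → U i k))
      ≈⟨ ∑-distrib-+ (Sterm G z s) (λ k → ΣR R (λ i → U i k)) ⟩
        Sfam G z s + ΣR R (λ k → ΣR R (λ i → U i k))
      ≈⟨ +-congˡ (∑-comm (λ k i → U i k)) ⟩
        Sfam G z s + ΣR R (λ i → ΣR R (λ k → U i k))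
      ≈⟨ +-congˡ (sum-cong-≋ (λ i → trans (sym (*-distribˡ-sum (z i) (V i)))
                                           (*-congˡ (ΣR-ifPos (s i) (Sterm F z (lower s i)))))) ⟩
        Sfam G z s + ΣR R (λ i → z i * ifPos 0# (s i) (Sfam F z (lower s i)))
      ∎
      where
      V U : Fin (suc m) → Fin (suc m) → Carrier
      V i k = ifPos 0# (s i) (Sterm F z (lower s i) k)
      U i k = z i * V i k

-- The recurrence for S itself, and its initial value S(z; 0) = 1
module SRecurrence {c ℓ : Level} (R : CommutativeRing c ℓ) where

  open import Data.Nat as ℕ using (zero; suc; _∸_; _≤_)
  open import Data.Nat.Properties using (≤-refl; ≤-pred) renaming (+-identityʳ to +-identityʳ-ℕ)
  open import Data.Fin using (zero; suc; punchIn)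
  open import Data.List using (upTo)
  open import Function using (_∘_)
  open import Relation.Binary.PropositionalEquality as P using (_≡_)
  open import Relation.Nullary using (contradiction)
  open CommutativeRing R hiding (zero)
  open import Relation.Binary.Reasoning.Setoid setoid
  open import Algebra.Properties.Semiring.Sum semiring using (sum-cong-≋; sum-cong-≗; ∑-distrib-+)
  open Multinomial using (lower; ifPos; δ₀; coef-α↓; coef-pascal; coef-cong; ΣN-lower)
  open BoxSums R
  open Recurrence R

  ι-+ : ∀ x y → ι R (x ℕ.+ y) ≈ ι R x + ι R y
  ι-+ zero    y = sym (+-identityˡ _)
  ι-+ (suc x) y = trans (+-congˡ (ι-+ x y)) (sym (+-assoc _ _ _))

  ι-ifPos : ∀ n x → ι R (ifPos 0 n x) ≡ ifPos 0# n (ι R x)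
  ι-ifPos zero    x = P.refl
  ι-ifPos (suc n) x = P.refl

  ι-ΣN : ∀ {m} (f : Fin m → ℕ) → ι R (ΣN f) ≈ ΣR R (λ i → ι R (f i))
  ι-ΣN {zero}  f = refl
  ι-ΣN {suc m} f = trans (ι-+ (f zero) _) (+-congˡ (ι-ΣN (f ∘ suc)))

  coefs coefs-α↓ : ∀ m → ℕ → Family m
  coefs    m α a j = ι R (coef m α a j)
  coefs-α↓ m α a j = ι R (coef-α↓ m α a j)

  coefs-pascal : ∀ m α → Pascal (coefs m α) (coefs-α↓ m α)
  coefs-pascal m α a j = begin
      ι R (coef m α a j)
    ≈⟨ reflexive (P.cong (ι R) (coef-pascal m α a j)) ⟩
      ι R (coef-α↓ m α a j ℕ.+ ifPos 0 a (coef m α (a ∸ 1) j) ℕ.+ ΣN shifted)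
    ≈⟨ trans (ι-+ (coef-α↓ m α a j ℕ.+ lowered) (ΣN shifted))
             (+-cong (ι-+ (coef-α↓ m α a j) lowered) (ι-ΣN shifted)) ⟩
      ι R (coef-α↓ m α a j) + ι R (ifPos 0 a (coef m α (a ∸ 1) j)) + ΣR R (λ i → ι R (shifted i))
    ≈⟨ reflexive (P.cong₂ (λ x y → ι R (coef-α↓ m α a j) + x + y) (ι-ifPos a _)
                    (sum-cong-≗ (λ i → ι-ifPos (j i) _))) ⟩
      ι R (coef-α↓ m α a j) + ifPos 0# a (ι R (coef m α (a ∸ 1) j))
        + ΣR R (λ i → ifPos 0# (j i) (ι R (coef m α a (lower j i))))
    ∎
    where
    lowered : ℕ
    lowered = ifPos 0 a (coef m α (a ∸ 1) j)
    shifted : Fin m → ℕ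
    shifted i = ifPos 0 (j i) (coef m α a (lower j i))

  coefs-ext : ∀ m α a → Extensional (coefs m α a)
  coefs-ext m α a e = reflexive (P.cong (ι R) (coef-cong m α a e))

  -- the basic recurrence: S(z; α) = S_α↓(z) + Σᵢ zᵢ S_{s − eᵢ}(z; α), where S_α↓
  -- uses the remainder coefficients; for α + 1 the remainder gives back S(z; α)
  S-recurrence : ∀ m α z s →
    S R m α z s ≈ Sfam (coefs-α↓ m α) z s + ΣR R (λ i → z i * Sdec R m α z s i)
  S-recurrence m α z s = Sfam-pascal (coefs-pascal m α) (coefs-ext m α) z s

  -- only the corner j = 0 of a box contributes to the generating function of [Σ j = 0]
  boxSum-δ₀ : ∀ {m} (b : Fin m → ℕ) w → boxSum b w (λ j → ι R (δ₀ (ΣN j))) ≈ 1#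
  boxSum-δ₀ {zero}  b w = trans (+-identityʳ _) (trans (*-identityʳ _) (+-identityʳ 1#))
  boxSum-δ₀ {suc m} b w = begin
      boxSum b w (λ j → ι R (δ₀ (ΣN j)))
    ≈⟨ boxSum-suc b w _ ⟩
      ΣL R (upTo (suc (b zero))) (λ t → pow R (w zero) t * boxSum b' w' (λ r → ι R (δ₀ (t ℕ.+ ΣN r))))
    ≈⟨ ΣL-upTo-suc (b zero) _ ⟩
      1# * boxSum b' w' (λ r → ι R (δ₀ (ΣN r)))
        + ΣL R (upTo (b zero)) (λ t → pow R (w zero) (suc t) * boxSum b' w' (λ _ → 0#))
    ≈⟨ +-cong (trans (*-identityˡ _) (boxSum-δ₀ b' w'))
              (trans (ΣL-cong (upTo (b zero)) (λ t → trans (*-congˡ (boxSum-zero b' w')) (zeroʳ _)))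
                     (ΣL-zero (upTo (b zero)))) ⟩
      1# + 0#
    ≈⟨ +-identityʳ 1# ⟩
      1#
    ∎
    where
    b' = b ∘ suc
    w' = w ∘ suc

  -- for α = 0 the k-th remainder summand is z_k^{s_k+1} [s_k = 0]; adding the
  -- correction z_k [s_k > 0] S_{s − e_k}(z; 0), where S_{s − e_k}(z; 0) = 1 by
  -- induction, gives z_k
  S₀-summand : ∀ {m} n x (b : Fin m → ℕ) w X → (∀ {n'} → n ≡ suc n' → X ≈ 1#) →
    pow R x (n ℕ.+ 1) * boxSum b w (coefs-α↓ m 0 n) + x * ifPos 0# n X ≈ x
  S₀-summand zero x b w X _ = begin
      x * 1# * boxSum b w (λ j → ι R (δ₀ (ΣN j) ℕ.+ 0)) + x * 0#
    ≈⟨ +-cong (*-cong (*-identityʳ x)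
                      (trans (boxSum-cong b w (λ j → reflexive (P.cong (ι R) (+-identityʳ-ℕ (δ₀ (ΣN j))))))
                             (boxSum-δ₀ b w)))
              (zeroʳ x) ⟩
      x * 1# + 0#
    ≈⟨ trans (+-identityʳ _) (*-identityʳ x) ⟩
      x
    ∎
  S₀-summand (suc n) x b w X X≈1 = begin
      pow R x (suc n ℕ.+ 1) * boxSum b w (λ _ → 0#) + x * X
    ≈⟨ +-cong (trans (*-congˡ (boxSum-zero b w)) (zeroʳ _)) (*-congˡ (X≈1 P.refl)) ⟩
      0# + x * 1#
    ≈⟨ trans (+-identityˡ _) (*-identityʳ x) ⟩
      x
    ∎

  module _ {m} (z : Fin (suc m) → Carrier) (Σz≈1 : ΣR R z ≈ 1#) where

    S₀-step : ∀ s → (∀ k {x} → s k ≡ suc x → S R m 0 z (lower s k) ≈ 1#) → S R m 0 z s ≈ 1#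
    S₀-step s IH = begin
        S R m 0 z s
      ≈⟨ S-recurrence m 0 z s ⟩
        Sfam (coefs-α↓ m 0) z s + ΣR R (λ k → z k * Sdec R m 0 z s k)
      ≈⟨ sym (∑-distrib-+ (Sterm (coefs-α↓ m 0) z s) (λ k → z k * Sdec R m 0 z s k)) ⟩
        ΣR R (λ k → Sterm (coefs-α↓ m 0) z s k + z k * Sdec R m 0 z s k)
      ≈⟨ sum-cong-≋ (λ k → S₀-summand (s k) (z k) (s ∘ punchIn k) (z ∘ punchIn k) _ (IH k)) ⟩
        ΣR R z
      ≈⟨ Σz≈1 ⟩
        1#
      ∎

    S₀-bounded : ∀ n s → ΣN s ≤ n → S R m 0 z s ≈ 1#
    S₀-bounded zero    s Σs≤0 =
      S₀-step s (λ k sₖ≡1+x → contradiction (P.subst (_≤ 0) (ΣN-lower s k sₖ≡1+x) Σs≤0) λ ())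
    S₀-bounded (suc n) s Σs≤n =
      S₀-step s (λ k sₖ≡1+x →
        S₀-bounded n (lower s k) (≤-pred (P.subst (_≤ suc n) (ΣN-lower s k sₖ≡1+x) Σs≤n)))

    S-at-zero : ∀ s → S R m 0 z s ≈ 1#
    S-at-zero s = S₀-bounded (ΣN s) s ≤-refl

lemma32 : ∀ {c ℓ : Level} (R : CommutativeRing c ℓ) →
          let open CommutativeRing R in
          (m : ℕ) (z : Fin (suc m) → Carrier) →
          ΣR R z ≈ 1# →
          ((α : ℕ) (s : Fin (suc m) → ℕ) →
             S R m (suc α) z s - ΣR R (λ i → z i * Sdec R m (suc α) z s i)
               ≈ S R m α z s)
          × ((s : Fin (suc m) → ℕ) →
             S R m 1 z s ≈ 1# + ΣR R (λ i → z i * Sdec R m 1 z s i))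
lemma32 R m z Σz≈1 = recurrence , at-one
  where
  open CommutativeRing R
  open SRecurrence R using (S-recurrence; S-at-zero)
  open import Algebra.Properties.Group +-group using (//-rightDividesʳ)

  correction : ℕ → (Fin (suc m) → ℕ) → Carrier
  correction α s = ΣR R (λ i → z i * Sdec R m α z s i)

  -- S(z; α+1) = S(z; α) + correction, since the remainder family of coef (α + 1) is coef α
  recurrence : ∀ α s → S R m (suc α) z s - correction (suc α) s ≈ S R m α z s
  recurrence α s = trans (+-congʳ (S-recurrence m (suc α) z s))
                         (//-rightDividesʳ (correction (suc α) s) (S R m α z s))

  at-one : ∀ s → S R m 1 z s ≈ 1# + correction 1 s
  at-one s = trans (S-recurrence m 1 z s) (+-congʳ (S-at-zero z Σz≈1 s))
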